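{- For every $k\geq 4$, the staircase permutation $E_k$ (of length $k^2-2k-2$) avoids every pattern in $B_k$. Consequently $N_k\geq k^2-2k-1$.
   Context: For $k\ge4$, $E_k$ is the permutation obtained by concatenating an increasing block $A$ of length $k-3$, then $k-2$ increasing blocks $C_1,\dots,C_{k-2}$ each of length $k-2$, arranged so that every entry of $C_i$ is larger than every entry of $C_j$ whenever $i<j$, and finally an increasing block $B$ of length $k-3$; equivalently $E_k=\operatorname{id}_{k-3}\oplus(\operatorname{id}_{k-2}\ominus\cdots\ominus\operatorname{id}_{k-2})\oplus\operatorname{id}_{k-3}$ with $k-2$ skew summands, where $\oplus$ is direct sum and $\ominus$ skew sum and $\operatorname{id}_m=12\cdots m$. For $k\ge3$, $p_k=12\cdots(k-2)\,k\,(k-1)$, $q_k=1\,k\,(k-1)\cdots 2$, $r_k=2\,1\,3\,4\cdots k$, $s_k=2\,3\cdots k\,1$, $B_k=\{p_k,q_k,r_k,s_k,p_k^c,q_k^c,r_k^c,s_k^c\}$ ($\cdot^c$ = complement). $N_k$ is the least integer such that $\operatorname{Av}_n(B_k)=\{\operatorname{id}_n,\operatorname{id}_n^r\}$ for all $n\geq N_k$, where $\operatorname{Av}_n(X)$ is the set of permutations of length $n$ avoiding every pattern of $X$. -}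

module Defs where

open import Data.Nat using (ℕ; zero; suc; _+_; _*_; _∸_; _<_; _≤_)
open import Data.List using (List; []; _∷_; _++_; map; length; upTo; reverse; lookup)
open import Data.List.Relation.Binary.Sublist.Propositional using (_⊆_)
open import Data.List.Relation.Binary.Permutation.Propositional using (_↭_)
open import Data.List.Relation.Unary.All using (All)
open import Data.Fin using (Fin; cast)
open import Data.Product using (Σ; ∃; _×_)
open import Data.Sum using (_⊎_)
open import Relation.Nullary using (¬_)
open import Relation.Binary.PropositionalEquality using (_≡_)
open import Function.Bundles using (_⇔_)

-- Convention: a permutation of length n is a list of naturals that is a
-- rearrangement of 0,1,...,n-1 (0-based values).

IsPerm : List ℕ → Set
IsPerm xs = xs ↭ upTo (length xs)

idP : ℕ → List ℕ
idP n = upTo n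

comp : List ℕ → List ℕ
comp xs = map (λ x → length xs ∸ 1 ∸ x) xs

_⊕_ : List ℕ → List ℕ → List ℕ
xs ⊕ ys = xs ++ map (length xs +_) ys

_⊖_ : List ℕ → List ℕ → List ℕ
xs ⊖ ys = map (length ys +_) xs ++ ys

infixl 6 _⊕_
infixr 7 _⊖_

skewPow : ℕ → ℕ → List ℕ
skewPow zero    j = []
skewPow (suc m) j = idP j ⊖ skewPow m j

E : ℕ → List ℕ
E k = idP (k ∸ 3) ⊕ skewPow (k ∸ 2) (k ∸ 2) ⊕ idP (k ∸ 3)

-- patterns (0-based versions of p_k, q_k, r_k, s_k)
-- p_k = 1 2 ... (k-2) k (k-1)
p : ℕ → List ℕ
p k = idP (k ∸ 2) ++ (k ∸ 1) ∷ (k ∸ 2) ∷ []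

-- q_k = 1 k (k-1) ... 2
q : ℕ → List ℕ
q k = 0 ∷ reverse (map suc (upTo (k ∸ 1)))

-- r_k = 2 1 3 4 ... k
r : ℕ → List ℕ
r k = 1 ∷ 0 ∷ map (2 +_) (upTo (k ∸ 2))

-- s_k = 2 3 ... k 1
s : ℕ → List ℕ
s k = map suc (upTo (k ∸ 1)) ++ 0 ∷ []

B : ℕ → List (List ℕ)
B k = p k ∷ q k ∷ r k ∷ s k ∷ comp (p k) ∷ comp (q k) ∷ comp (r k) ∷ comp (s k) ∷ []

OrderIso : List ℕ → List ℕ → Set
OrderIso ys π = Σ (length ys ≡ length π) λ eq →
  ∀ (i j : Fin (length ys)) →
    (lookup ys i < lookup ys j) ⇔ (lookup π (cast eq i) < lookup π (cast eq j))

Contains : List ℕ → List ℕ → Set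
Contains σ π = ∃ λ ys → ys ⊆ σ × OrderIso ys π

Avoids : List ℕ → List ℕ → Set
Avoids σ π = ¬ Contains σ π

AvoidsAll : List (List ℕ) → List ℕ → Set
AvoidsAll X σ = All (Avoids σ) X

-- N is a threshold: for all n ≥ N, Av_n(B_k) = {id_n, id_n^r}.
-- N_k is the least such N; "N_k ≥ m" is stated as: every threshold is ≥ m.
IsThreshold : ℕ → ℕ → Set
IsThreshold k N = ∀ n → N ≤ n → ∀ (σ : List ℕ) → length σ ≡ n → IsPerm σ →
  (AvoidsAll (B k) σ ⇔ (σ ≡ idP n ⊎ σ ≡ reverse (idP n)))

{-# OPTIONS --safe #-}
-- Write a = k - 3 and m = k - 2, so E_k = id_a ⊕ S ⊕ id_a where S = id_m ⊖ ⋯ ⊖ id_m has m blocks.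
-- If x comes before y in E_k and y < x, then both lie in S and y lies in a lower block; if x < y
-- and both lie in S, they lie in the same block, so y < x + m. Hence E_k has no decreasing
-- subsequence of length k - 1, which excludes q_k, p_k^c, r_k^c and s_k^c, and no increasing
-- subsequence of length k - 1 that starts and ends in S, which excludes s_k and q_k^c. For p_k and
-- r_k, one descent and one ascent inside S place three entries in blocks that contradict the
-- monotonicity of the block index. Finally E_k is a permutation of length k² - 2k - 2 other than
-- the identity and its reverse, so every threshold exceeds that length.
module Submission where

open import Defs
open import Data.Nat using (ℕ; zero; suc; _+_; _*_; _∸_; _<_; _≤_; z≤n; s≤s; z<s; NonZero; >-nonZero⁻¹)
open import Data.Nat.Properties
open import Data.Nat.DivMod using (_/_; _%_; m≡m%n+[m/n]*n; m%n<n; m/n*n≤m; m*n/n≡m; m<n⇒m/n≡0; +-distrib-/-∣ʳ; /-monoˡ-≤; m<n*o⇒m/o<n)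
open import Data.Nat.Divisibility using (n∣m*n)
open import Data.Nat.Tactic.RingSolver using (solve-∀)
open import Data.Fin using (Fin; toℕ; fromℕ<; cast)
import Data.Fin.Properties as Fin
open import Data.List using (List; []; _∷_; _++_; map; length; upTo; applyUpTo; applyDownFrom; reverse; lookup)
import Data.List.Properties as List
open import Data.List.Relation.Unary.All as All using (All; []; _∷_)
import Data.List.Relation.Unary.All.Properties as Allₚ
open import Data.List.Relation.Unary.AllPairs as AllPairs using (AllPairs; []; _∷_)
import Data.List.Relation.Unary.AllPairs.Properties as AllPairsₚ
open import Data.List.Relation.Binary.Sublist.Propositional using (_⊆_; []; _∷_; _∷ʳ_)
open import Data.List.Relation.Binary.Sublist.Propositional.Properties using (All-resp-⊆)
open import Data.List.Relation.Binary.Permutation.Propositional using (↭-refl; ↭-reflexive; ↭-sym; module PermutationReasoning)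
import Data.List.Relation.Binary.Permutation.Propositional.Properties as ↭
open import Data.Product using (_×_; _,_; proj₁; proj₂)
open import Data.Sum using (inj₁; inj₂; [_,_])
open import Data.Empty using (⊥; ⊥-elim)
open import Function using (_∘_; id)
open import Function.Bundles using (Equivalence)
open import Relation.Nullary using (yes; no)
open import Relation.Binary.PropositionalEquality using (_≡_; _≢_; refl; sym; trans; cong; cong₂; subst; subst₂; module ≡-Reasoning)

-- Past the end nth returns the junk value 0; every lemma below assumes an in-range index.
nth : List ℕ → ℕ → ℕ
nth []       _       = 0
nth (x ∷ _)  zero    = x
nth (_ ∷ xs) (suc i) = nth xs i

lookup≡nth : ∀ xs (i : Fin (length xs)) → lookup xs i ≡ nth xs (toℕ i)
lookup≡nth (x ∷ xs) Fin.zero    = refl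
lookup≡nth (x ∷ xs) (Fin.suc i) = lookup≡nth xs i

nth-++ˡ : ∀ xs {ys i} → i < length xs → nth (xs ++ ys) i ≡ nth xs i
nth-++ˡ (x ∷ xs) {i = zero}  _         = refl
nth-++ˡ (x ∷ xs) {i = suc i} (s≤s i<n) = nth-++ˡ xs i<n

nth-++ʳ : ∀ xs {ys} i {n} → length xs ≡ n → nth (xs ++ ys) (i + n) ≡ nth ys i
nth-++ʳ xs {ys} i refl = trans (cong (nth (xs ++ ys)) (+-comm i (length xs))) (skip xs)
  where
  skip : ∀ xs → nth (xs ++ ys) (length xs + i) ≡ nth ys i
  skip []       = refl
  skip (x ∷ xs) = skip xs

nth-map : ∀ (f : ℕ → ℕ) xs {i} → i < length xs → nth (map f xs) i ≡ f (nth xs i)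
nth-map f (x ∷ xs) {zero}  _         = refl
nth-map f (x ∷ xs) {suc i} (s≤s i<n) = nth-map f xs i<n

nth-applyUpTo : ∀ (f : ℕ → ℕ) {n i} → i < n → nth (applyUpTo f n) i ≡ f i
nth-applyUpTo f {suc n} {zero}  _         = refl
nth-applyUpTo f {suc n} {suc i} (s≤s i<n) = nth-applyUpTo (f ∘ suc) i<n

nth-applyDownFrom : ∀ (f : ℕ → ℕ) {n i} → i < n → nth (applyDownFrom f n) i ≡ f (n ∸ suc i)
nth-applyDownFrom f {suc n} {zero}  _         = refl
nth-applyDownFrom f {suc n} {suc i} (s≤s i<n) = nth-applyDownFrom f i<n

<-length-upTo : ∀ {i n} → i < n → i < length (upTo n)
<-length-upTo {i} {n} = subst (i <_) (sym (List.length-upTo n))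

All-nth : ∀ {P : ℕ → Set} {xs i} → All P xs → i < length xs → P (nth xs i)
All-nth {i = zero}  (px ∷ _)   _         = px
All-nth {i = suc i} (_  ∷ pxs) (s≤s i<n) = All-nth pxs i<n

AllPairs-nth : ∀ {R : ℕ → ℕ → Set} {xs i j} → AllPairs R xs → i < j → j < length xs → R (nth xs i) (nth xs j)
AllPairs-nth {i = zero}  {suc j} (rx ∷ _)   _         (s≤s j<n) = All-nth rx j<n
AllPairs-nth {i = suc i} {suc j} (_  ∷ rxs) (s≤s i<j) (s≤s j<n) = AllPairs-nth rxs i<j j<n

AllPairs-resp-⊆ : ∀ {R : ℕ → ℕ → Set} {xs ys} → ys ⊆ xs → AllPairs R xs → AllPairs R ys
AllPairs-resp-⊆ []          []         = []
AllPairs-resp-⊆ (_    ∷ʳ τ) (_  ∷ rxs) = AllPairs-resp-⊆ τ rxs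
AllPairs-resp-⊆ (refl ∷  τ) (rx ∷ rxs) = All-resp-⊆ τ rx ∷ AllPairs-resp-⊆ τ rxs

AllPairs-withˡ : ∀ {P : ℕ → Set} {R : ℕ → ℕ → Set} {xs} → All P xs → AllPairs R xs →
                 AllPairs (λ x y → P x × R x y) xs
AllPairs-withˡ []         []         = []
AllPairs-withˡ (px ∷ pxs) (rx ∷ rxs) = All.map (px ,_) rx ∷ AllPairs-withˡ pxs rxs

All-across : ∀ {P Q : ℕ → Set} {R : ℕ → ℕ → Set} {xs ys} → (∀ {x y} → P x → Q y → R x y) →
             All P xs → All Q ys → All (λ x → All (R x) ys) xs
All-across r pxs qys = All.map (λ px → All.map (r px) qys) pxs

-- Occurrences of a pattern

-- at i is the entry of the host list matched with the i-th entry of π.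
record Occurrence (R : ℕ → ℕ → Set) (P : ℕ → Set) (π : List ℕ) (ℓ : ℕ) : Set where
  field
    at        : ℕ → ℕ
    precedes  : ∀ {i j} → i < j → j < ℓ → R (at i) (at j)
    satisfies : ∀ {i} → i < ℓ → P (at i)
    ordered   : ∀ {i j} → i < ℓ → j < ℓ → nth π i < nth π j → at i < at j

occurrence : ∀ {R : ℕ → ℕ → Set} {P : ℕ → Set} {σ π ℓ} → AllPairs R σ → All P σ → length π ≡ ℓ →
             Contains σ π → Occurrence R P π ℓ
occurrence {π = π} Rσ Pσ refl (ys , ys⊆σ , same-length , iso) = record
  { at        = nth ys
  ; precedes  = λ i<j j<ℓ → AllPairs-nth (AllPairs-resp-⊆ ys⊆σ Rσ) i<j (inRange j<ℓ)
  ; satisfies = λ i<ℓ → All-nth (All-resp-⊆ ys⊆σ Pσ) (inRange i<ℓ)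
  ; ordered   = λ i<ℓ j<ℓ πi<πj → subst₂ _<_ (atIndex ys (inRange i<ℓ)) (atIndex ys (inRange j<ℓ))
                  (Equivalence.from (iso _ _) (subst₂ _<_ (sym (atCast i<ℓ)) (sym (atCast j<ℓ)) πi<πj))
  }
  where
  inRange : ∀ {i} → i < length π → i < length ys
  inRange = subst (_ <_) (sym same-length)
  atIndex : ∀ xs {i} (i<n : i < length xs) → lookup xs (fromℕ< i<n) ≡ nth xs i
  atIndex xs i<n = trans (lookup≡nth xs _) (cong (nth xs) (Fin.toℕ-fromℕ< i<n))
  atCast : ∀ {i} (i<ℓ : i < length π) → lookup π (cast same-length (fromℕ< (inRange i<ℓ))) ≡ nth π i
  atCast i<ℓ = trans (lookup≡nth π _) (cong (nth π) (trans (Fin.toℕ-cast same-length _) (Fin.toℕ-fromℕ< _)))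

nth-comp-< : ∀ π {ℓ i j} → length π ≡ ℓ → i < ℓ → j < ℓ → nth π j < nth π i → nth π i < ℓ →
             nth (comp π) i < nth (comp π) j
nth-comp-< π {ℓ} {i} {j} refl i<ℓ j<ℓ πj<πi πi<ℓ = begin-strict
  nth (comp π) i         ≡⟨ nth-map _ π i<ℓ ⟩
  ℓ ∸ 1 ∸ nth π i        <⟨ ∸-monoʳ-< πj<πi (subst (nth π i ≤_) (pred[m∸n]≡m∸[1+n] ℓ 0) (<⇒≤pred πi<ℓ)) ⟩
  ℓ ∸ 1 ∸ nth π j        ≡⟨ sym (nth-map _ π j<ℓ) ⟩
  nth (comp π) j         ∎
  where open ≤-Reasoning

ascending-run-gap : ∀ (g : ℕ → ℕ) L → (∀ i → i < L → g i < g (suc i)) → g 0 + L ≤ g L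
ascending-run-gap g zero    _    = ≤-reflexive (+-identityʳ (g 0))
ascending-run-gap g (suc L) step = begin
  g 0 + suc L   ≡⟨ +-suc (g 0) L ⟩
  suc (g 0 + L) ≤⟨ s≤s (ascending-run-gap g L (λ i i<L → step i (m<n⇒m<1+n i<L))) ⟩
  suc (g L)     ≤⟨ step L ≤-refl ⟩
  g (suc L)     ∎
  where open ≤-Reasoning

descending-run-gap : ∀ (g : ℕ → ℕ) L → (∀ i → i < L → g (suc i) < g i) → g L + L ≤ g 0
descending-run-gap g zero    _    = ≤-reflexive (+-identityʳ (g 0))
descending-run-gap g (suc L) step = begin
  g (suc L) + suc L   ≡⟨ +-suc (g (suc L)) L ⟩
  suc (g (suc L) + L) ≤⟨ +-monoˡ-≤ L (step L ≤-refl) ⟩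
  g L + L             ≤⟨ descending-run-gap g L (λ i i<L → step i (m<n⇒m<1+n i<L)) ⟩
  g 0                 ∎
  where open ≤-Reasoning

-- Direct and skew sums of permutations

length-⊕ : ∀ xs ys → length (xs ⊕ ys) ≡ length xs + length ys
length-⊕ xs ys = trans (List.length-++ xs) (cong (length xs +_) (List.length-map _ ys))

length-⊖ : ∀ xs ys → length (xs ⊖ ys) ≡ length xs + length ys
length-⊖ xs ys = trans (List.length-++ (map _ xs)) (cong (_+ length ys) (List.length-map _ xs))

⊕-with-length : ∀ xs ys {n} → length xs ≡ n → xs ⊕ ys ≡ xs ++ map (n +_) ys
⊕-with-length xs ys = cong (λ n → xs ++ map (n +_) ys)

⊖-with-length : ∀ xs ys {n} → length ys ≡ n → xs ⊖ ys ≡ map (n +_) xs ++ ys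
⊖-with-length xs ys = cong (λ n → map (n +_) xs ++ ys)

applyUpTo-+ : ∀ (f : ℕ → ℕ) m n → applyUpTo f (m + n) ≡ applyUpTo f m ++ applyUpTo (f ∘ (m +_)) n
applyUpTo-+ f zero    n = refl
applyUpTo-+ f (suc m) n = cong (f 0 ∷_) (applyUpTo-+ (f ∘ suc) m n)

upTo-+ : ∀ m n → upTo (m + n) ≡ upTo m ++ map (m +_) (upTo n)
upTo-+ m n = trans (applyUpTo-+ id m n) (cong (upTo m ++_) (sym (List.map-upTo (m +_) n)))

IsPerm⇒bounded : ∀ {xs} → IsPerm xs → All (_< length xs) xs
IsPerm⇒bounded {xs} xs↭ = ↭.All-resp-↭ (↭-sym xs↭) (Allₚ.applyUpTo⁺₁ id (length xs) id)

IsPerm-idP : ∀ n → IsPerm (idP n)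
IsPerm-idP n = ↭-reflexive (cong upTo (sym (List.length-upTo n)))

IsPerm-⊕ : ∀ {xs ys} → IsPerm xs → IsPerm ys → IsPerm (xs ⊕ ys)
IsPerm-⊕ {xs} {ys} xs↭ ys↭ = begin
  xs ++ map (length xs +_) ys                        ↭⟨ ↭.++⁺ xs↭ (↭.map⁺ _ ys↭) ⟩
  upTo (length xs) ++ map (length xs +_) (upTo (length ys)) ≡⟨ upTo-+ (length xs) (length ys) ⟨
  upTo (length xs + length ys)                       ≡⟨ cong upTo (length-⊕ xs ys) ⟨
  upTo (length (xs ⊕ ys))                            ∎
  where open PermutationReasoning

IsPerm-⊖ : ∀ {xs ys} → IsPerm xs → IsPerm ys → IsPerm (xs ⊖ ys)
IsPerm-⊖ {xs} {ys} xs↭ ys↭ = begin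
  map (length ys +_) xs ++ ys                        ↭⟨ ↭.++-comm (map _ xs) ys ⟩
  ys ++ map (length ys +_) xs                        ↭⟨ ↭.++⁺ ys↭ (↭.map⁺ _ xs↭) ⟩
  upTo (length ys) ++ map (length ys +_) (upTo (length xs)) ≡⟨ upTo-+ (length ys) (length xs) ⟨
  upTo (length ys + length xs)                       ≡⟨ cong upTo (trans (length-⊖ xs ys) (+-comm (length xs) (length ys))) ⟨
  upTo (length (xs ⊖ ys))                            ∎
  where open PermutationReasoning

length-skewPow : ∀ b j → length (skewPow b j) ≡ b * j
length-skewPow zero    j = refl
length-skewPow (suc b) j = trans (length-⊖ (idP j) (skewPow b j))
                                 (cong₂ _+_ (List.length-upTo j) (length-skewPow b j))

IsPerm-skewPow : ∀ b j → IsPerm (skewPow b j)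
IsPerm-skewPow zero    j = ↭-refl
IsPerm-skewPow (suc b) j = IsPerm-⊖ (IsPerm-idP j) (IsPerm-skewPow b j)

skewPow-bounded : ∀ b j → All (_< b * j) (skewPow b j)
skewPow-bounded b j = subst (λ n → All (_< n) (skewPow b j)) (length-skewPow b j) (IsPerm⇒bounded (IsPerm-skewPow b j))

-- Blocks of a skew sum of increasing runs

[m*n+o]/n≡m : ∀ m {n o} .{{_ : NonZero n}} → o < n → (m * n + o) / n ≡ m
[m*n+o]/n≡m m {n} {o} o<n = begin
  (m * n + o) / n   ≡⟨ cong (_/ n) (+-comm (m * n) o) ⟩
  (o + m * n) / n   ≡⟨ +-distrib-/-∣ʳ o (n∣m*n m) ⟩
  o / n + m * n / n ≡⟨ cong₂ _+_ (m<n⇒m/n≡0 o<n) (m*n/n≡m m n) ⟩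
  m                 ∎
  where open ≡-Reasoning

m/o≡n/o⇒n<m+o : ∀ {m n o} .{{_ : NonZero o}} → m / o ≡ n / o → n < m + o
m/o≡n/o⇒n<m+o {m} {n} {o} m/o≡n/o = begin-strict
  n                 ≡⟨ m≡m%n+[m/n]*n n o ⟩
  n % o + n / o * o <⟨ +-monoˡ-< (n / o * o) (m%n<n n o) ⟩
  o + n / o * o     ≡⟨ cong (λ q → o + q * o) m/o≡n/o ⟨
  o + m / o * o     ≤⟨ +-monoʳ-≤ o (m/n*n≤m m o) ⟩
  o + m             ≡⟨ +-comm o m ⟩
  m + o             ∎
  where open ≤-Reasoning

m/o<n/o⇒m<n : ∀ {m n o} .{{_ : NonZero o}} → m / o < n / o → m < n
m/o<n/o⇒m<n {o = o} m/o<n/o = ≰⇒> (λ n≤m → <⇒≱ m/o<n/o (/-monoˡ-≤ o n≤m))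

-- x / j is the block of id_j ⊖ ⋯ ⊖ id_j containing x, counted from the bottom.
data SkewOrdered (j : ℕ) .{{_ : NonZero j}} (x y : ℕ) : Set where
  within : x / j ≡ y / j → x < y → SkewOrdered j x y
  across : y / j < x / j → SkewOrdered j x y

SkewOrdered-<⇒same-quotient : ∀ {j x y} .{{_ : NonZero j}} → SkewOrdered j x y → x < y → x / j ≡ y / j
SkewOrdered-<⇒same-quotient (within x/j≡y/j _) _   = x/j≡y/j
SkewOrdered-<⇒same-quotient (across y/j<x/j)   x<y = ⊥-elim (<-asym x<y (m/o<n/o⇒m<n y/j<x/j))

SkewOrdered⇒<+ : ∀ {j x y} .{{_ : NonZero j}} → SkewOrdered j x y → y < x + j
SkewOrdered⇒<+ (within x/j≡y/j _) = m/o≡n/o⇒n<m+o x/j≡y/j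
SkewOrdered⇒<+ {j} {x} (across y/j<x/j) = <-≤-trans (m/o<n/o⇒m<n y/j<x/j) (m≤m+n x j)

skewPow-skewOrdered : ∀ b j .{{_ : NonZero j}} → AllPairs (SkewOrdered j) (skewPow b j)
skewPow-skewOrdered zero    j = []
skewPow-skewOrdered (suc b) j =
  subst (AllPairs (SkewOrdered j)) (sym (⊖-with-length (idP j) (skewPow b j) (length-skewPow b j)))
    (AllPairsₚ.++⁺ top (skewPow-skewOrdered b j) (All-across below topQuotient restQuotient))
  where
  top : AllPairs (SkewOrdered j) (map (b * j +_) (upTo j))
  top = AllPairsₚ.map⁺ (AllPairsₚ.applyUpTo⁺₁ id j λ t<u u<j →
          within (trans ([m*n+o]/n≡m b (<-trans t<u u<j)) (sym ([m*n+o]/n≡m b u<j))) (+-monoʳ-< (b * j) t<u))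
  topQuotient : All (λ x → x / j ≡ b) (map (b * j +_) (upTo j))
  topQuotient = Allₚ.map⁺ (Allₚ.applyUpTo⁺₁ id j ([m*n+o]/n≡m b))
  restQuotient : All (λ y → y / j < b) (skewPow b j)
  restQuotient = All.map m<n*o⇒m/o<n (skewPow-bounded b j)
  below : ∀ {x y} → x / j ≡ b → y / j < b → SkewOrdered j x y
  below x/j≡b y/j<b = across (subst (_ <_) (sym x/j≡b) y/j<b)

-- Staircases

staircase : ℕ → ℕ → ℕ → List ℕ
staircase a b j = idP a ⊕ skewPow b j ⊕ idP a

module Staircase (a b j : ℕ) .{{_ : NonZero j}} where

  block : ℕ → ℕ
  block x = (x ∸ a) / j

  data Precedes : ℕ → ℕ → Set where
    left   : ∀ {x y} → x < a → x < y → Precedes x y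
    right  : ∀ {x y} → a + b * j ≤ y → x < y → Precedes x y
    middle : ∀ {x y} → x < b * j → SkewOrdered j x y → Precedes (a + x) (a + y)

  lower : List ℕ
  lower = idP a ⊕ skewPow b j

  length-lower : length lower ≡ a + b * j
  length-lower = trans (length-⊕ (idP a) (skewPow b j)) (cong₂ _+_ (List.length-upTo a) (length-skewPow b j))

  length-staircase : length (staircase a b j) ≡ a + b * j + a
  length-staircase = trans (length-⊕ lower (idP a)) (cong₂ _+_ length-lower (List.length-upTo a))

  IsPerm-staircase : IsPerm (staircase a b j)
  IsPerm-staircase = IsPerm-⊕ (IsPerm-⊕ (IsPerm-idP a) (IsPerm-skewPow b j)) (IsPerm-idP a)

  staircase-bounded : All (_< a + b * j + a) (staircase a b j)
  staircase-bounded = subst (λ n → All (_< n) (staircase a b j)) length-staircase (IsPerm⇒bounded IsPerm-staircase)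

  staircase-precedes : AllPairs Precedes (staircase a b j)
  staircase-precedes = subst (AllPairs Precedes) (sym (⊕-with-length lower (idP a) length-lower))
    (AllPairsₚ.++⁺ lowerPairs topPairs (All-across (λ x<n n≤y → right n≤y (<-≤-trans x<n n≤y)) lowerBound topLower))
    where
    firstPairs : AllPairs Precedes (upTo a)
    firstPairs = AllPairsₚ.applyUpTo⁺₁ id a λ x<y y<a → left (<-trans x<y y<a) x<y
    middlePairs : AllPairs Precedes (map (a +_) (skewPow b j))
    middlePairs = AllPairsₚ.map⁺ (AllPairs.map (λ (x<n , x≺y) → middle x<n x≺y)
                    (AllPairs-withˡ (skewPow-bounded b j) (skewPow-skewOrdered b j)))
    lowerPairs : AllPairs Precedes lower
    lowerPairs = subst (AllPairs Precedes) (sym (⊕-with-length (idP a) (skewPow b j) (List.length-upTo a)))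
      (AllPairsₚ.++⁺ firstPairs middlePairs
        (All-across (λ x<a a≤y → left x<a (<-≤-trans x<a a≤y))
          (Allₚ.applyUpTo⁺₁ id a id) (Allₚ.map⁺ (All.universal (m≤m+n a) (skewPow b j)))))
    lowerBound : All (_< a + b * j) lower
    lowerBound = subst (λ n → All (_< n) lower) length-lower (IsPerm⇒bounded (IsPerm-⊕ (IsPerm-idP a) (IsPerm-skewPow b j)))
    topPairs : AllPairs Precedes (map (a + b * j +_) (upTo a))
    topPairs = AllPairsₚ.map⁺ (AllPairsₚ.applyUpTo⁺₁ id a λ x<y _ → right (m≤m+n _ _) (+-monoʳ-< _ x<y))
    topLower : All (a + b * j ≤_) (map (a + b * j +_) (upTo a))
    topLower = Allₚ.map⁺ (All.universal (m≤m+n (a + b * j)) (upTo a))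

  block-shift : ∀ x → block (a + x) ≡ x / j
  block-shift x = cong (_/ j) (m+n∸m≡n a x)

  block-mono : ∀ {x y} → x ≤ y → block x ≤ block y
  block-mono x≤y = /-monoˡ-≤ j (∸-monoˡ-≤ a x≤y)

  block-< : ∀ {x} → a ≤ x → x < a + b * j → block x < b
  block-< {x} a≤x x<a+n = m<n*o⇒m/o<n (+-cancelˡ-< a (x ∸ a) (b * j) (subst (_< a + b * j) (sym (m+[n∸m]≡n a≤x)) x<a+n))

  descent : ∀ {x y} → Precedes x y → y < x → a ≤ y × x < a + b * j × block y < block x
  descent (left _ x<y)               y<x = ⊥-elim (<-asym x<y y<x)
  descent (right _ x<y)              y<x = ⊥-elim (<-asym x<y y<x)
  descent (middle _ (within _ x<y))  y<x = ⊥-elim (<-asym (+-monoʳ-< a x<y) y<x)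
  descent (middle {x} {y} x<n (across y/j<x/j)) _ =
    m≤m+n a y , +-monoʳ-< a x<n , subst₂ _<_ (sym (block-shift y)) (sym (block-shift x)) y/j<x/j

  same-block : ∀ {x y} → Precedes x y → x < y → a ≤ x → y < a + b * j → block x ≡ block y
  same-block (left x<a _)  _ a≤x _      = ⊥-elim (<⇒≱ x<a a≤x)
  same-block (right n≤y _) _ _   y<a+n  = ⊥-elim (<⇒≱ y<a+n n≤y)
  same-block (middle {x} {y} _ x≺y) x<y _ _ =
    trans (block-shift x) (trans (SkewOrdered-<⇒same-quotient x≺y (+-cancelˡ-< a x y x<y)) (sym (block-shift y)))

  no-long-ascent : ∀ {x y} → Precedes x y → a ≤ x → y < a + b * j → x + j ≤ y → ⊥
  no-long-ascent (left x<a _)  a≤x _     _ = <⇒≱ x<a a≤x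
  no-long-ascent (right n≤y _) _   y<a+n _ = <⇒≱ y<a+n n≤y
  no-long-ascent (middle {x} {y} _ x≺y) _ _ x+j≤y =
    <⇒≱ (+-monoʳ-< a (SkewOrdered⇒<+ x≺y)) (subst (_≤ a + y) (+-assoc a x j) x+j≤y)

  no-long-descent : .{{_ : NonZero b}} → (g : ℕ → ℕ) →
                    (∀ i → i < b → Precedes (g i) (g (suc i)) × g (suc i) < g i) → ⊥
  no-long-descent g steps = <⇒≱ (block-< a≤g0 g0<a+n) (≤-trans (m≤n+m b _) (descending-run-gap (block ∘ g) b block-steps))
    where
    descentAt : ∀ i → i < b → a ≤ g (suc i) × g i < a + b * j × block (g (suc i)) < block (g i)
    descentAt i i<b = descent (proj₁ (steps i i<b)) (proj₂ (steps i i<b))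
    block-steps : ∀ i → i < b → block (g (suc i)) < block (g i)
    block-steps i i<b = proj₂ (proj₂ (descentAt i i<b))
    a≤g0 : a ≤ g 0
    a≤g0 = ≤-trans (proj₁ (descentAt 0 (>-nonZero⁻¹ b))) (<⇒≤ (proj₂ (steps 0 (>-nonZero⁻¹ b))))
    g0<a+n : g 0 < a + b * j
    g0<a+n = proj₁ (proj₂ (descentAt 0 (>-nonZero⁻¹ b)))

-- For k = 4 + c, E k is by definition staircase a m m with a = k - 3 and m = k - 2.
module _ (c : ℕ) where

  private
    a m k nn : ℕ
    a  = 1 + c
    m  = 2 + c
    k  = 4 + c
    nn = a + m * m + a

    m<k : m < k
    m<k = <-trans (n<1+n m) (n<1+n (suc m))

  open Staircase a m m

  length-p : length (p k) ≡ k
  length-p = trans (List.length-++ (upTo m)) (trans (cong (_+ 2) (List.length-upTo m)) (+-comm m 2))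

  p-init : ∀ {i} → i < m → nth (p k) i ≡ i
  p-init i<m = trans (nth-++ˡ (upTo m) (<-length-upTo i<m)) (nth-applyUpTo id i<m)

  p-penultimate : nth (p k) m ≡ suc m
  p-penultimate = nth-++ʳ (upTo m) 0 (List.length-upTo m)

  p-last : nth (p k) (suc m) ≡ m
  p-last = nth-++ʳ (upTo m) 1 (List.length-upTo m)

  p-ascends : ∀ {i} → i < m → nth (p k) i < nth (p k) (suc i) × nth (p k) (suc i) < k
  p-ascends {i} i<m with m≤n⇒m<n∨m≡n i<m
  ... | inj₁ 1+i<m = subst₂ _<_ (sym (p-init i<m)) (sym (p-init 1+i<m)) (n<1+n i)
                   , subst (_< k) (sym (p-init 1+i<m)) (<-trans 1+i<m m<k)
  ... | inj₂ refl  = subst₂ _<_ (sym (p-init i<m)) (sym p-penultimate) (<-trans i<m (n<1+n m))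
                   , subst (_< k) (sym p-penultimate) (n<1+n (suc m))

  length-q : length (q k) ≡ k
  length-q = cong suc (trans (List.length-reverse (map suc (upTo (suc m))))
                             (trans (List.length-map suc (upTo (suc m))) (List.length-upTo (suc m))))

  q-tail : ∀ {i} → i < suc m → nth (q k) (suc i) ≡ suc (m ∸ i)
  q-tail i<1+m = trans (cong (λ xs → nth xs _) reversed) (nth-applyDownFrom suc i<1+m)
    where
    reversed : reverse (map suc (upTo (suc m))) ≡ applyDownFrom suc (suc m)
    reversed = trans (cong reverse (List.map-upTo suc (suc m))) (List.reverse-applyUpTo suc (suc m))

  q-descends : ∀ {i} → i < m → nth (q k) (suc (suc i)) < nth (q k) (suc i)
  q-descends {i} i<m = subst₂ _<_ (sym (q-tail (s≤s i<m))) (sym (q-tail (m<n⇒m<1+n i<m)))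
                              (s≤s (∸-monoʳ-< (n<1+n i) i<m))

  q-bounded : ∀ {i} → i < suc m → nth (q k) (suc i) < k
  q-bounded {i} i<1+m = subst (_< k) (sym (q-tail i<1+m)) (s≤s (s≤s (m∸n≤m m i)))

  length-r : length (r k) ≡ k
  length-r = cong (2 +_) (trans (List.length-map (2 +_) (upTo m)) (List.length-upTo m))

  r-tail : ∀ {i} → i < m → nth (r k) (2 + i) ≡ 2 + i
  r-tail i<m = trans (nth-map (2 +_) (upTo m) (<-length-upTo i<m))
                     (cong (2 +_) (nth-applyUpTo id i<m))

  private
    length-s-init : length (map suc (upTo (suc m))) ≡ suc m
    length-s-init = trans (List.length-map suc (upTo (suc m))) (List.length-upTo (suc m))

  length-s : length (s k) ≡ k
  length-s = trans (List.length-++ (map suc (upTo (suc m)))) (trans (cong (_+ 1) length-s-init) (+-comm (suc m) 1))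

  s-init : ∀ {i} → i < suc m → nth (s k) i ≡ suc i
  s-init {i} i<1+m = trans (nth-++ˡ (map suc (upTo (suc m))) (subst (i <_) (sym length-s-init) i<1+m))
                           (trans (nth-map suc (upTo (suc m)) (<-length-upTo i<1+m)) (cong suc (nth-applyUpTo id i<1+m)))

  s-last : nth (s k) (suc m) ≡ 0
  s-last = nth-++ʳ (map suc (upTo (suc m))) 0 length-s-init

  E-occurrence : ∀ {π} → length π ≡ k → Contains (E k) π → Occurrence Precedes (_< nn) π k
  E-occurrence = occurrence staircase-precedes staircase-bounded

  no-descending-run : ∀ {π} → Occurrence Precedes (_< nn) π k → (idx : ℕ → ℕ) →
    (∀ i → i < m → idx i < idx (suc i) × idx (suc i) < k × nth π (idx (suc i)) < nth π (idx i)) → ⊥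
  no-descending-run O idx run = no-long-descent (at ∘ idx) λ i i<m →
    let (idx< , idx<k , below) = run i i<m in precedes idx< idx<k , ordered idx<k (<-trans idx< idx<k) below
    where open Occurrence O

  E-avoids-p : Avoids (E k) (p k)
  E-avoids-p occ = <-irrefl same-blocks lower-block
    where
    open Occurrence (E-occurrence length-p occ)
    a<k : a < k
    a<k = <-trans (n<1+n a) m<k
    top-descent : a ≤ at (suc m) × at m < a + m * m × block (at (suc m)) < block (at m)
    top-descent = descent (precedes (n<1+n m) (n<1+n (suc m)))
      (ordered (n<1+n (suc m)) m<k (subst₂ _<_ (sym p-last) (sym p-penultimate) (n<1+n m)))
    a-below-m : at a < at m
    a-below-m = ordered a<k m<k (subst₂ _<_ (sym (p-init (n<1+n a))) (sym p-penultimate) (<-trans (n<1+n a) (n<1+n m)))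
    a-below-last : at a < at (suc m)
    a-below-last = ordered a<k (n<1+n (suc m)) (subst₂ _<_ (sym (p-init (n<1+n a))) (sym p-last) (n<1+n a))
    a≤at-a : a ≤ at a
    a≤at-a = ≤-trans (m≤n+m a (at 0)) (ascending-run-gap at a λ i i<a →
               ordered (<-trans i<a a<k) (≤-<-trans i<a a<k) (proj₁ (p-ascends (<-trans i<a (n<1+n a)))))
    same-blocks : block (at a) ≡ block (at m)
    same-blocks = same-block (precedes (n<1+n a) m<k) a-below-m a≤at-a (proj₁ (proj₂ top-descent))
    lower-block : block (at a) < block (at m)
    lower-block = ≤-<-trans (block-mono (<⇒≤ a-below-last)) (proj₂ (proj₂ top-descent))

  E-avoids-q : Avoids (E k) (q k)
  E-avoids-q occ = no-descending-run (E-occurrence length-q occ) suc λ i i<m →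
    n<1+n (suc i) , s≤s (s≤s i<m) , q-descends i<m

  E-avoids-r : Avoids (E k) (r k)
  E-avoids-r occ = <-irrefl same-blocks lower-block
    where
    open Occurrence (E-occurrence length-r occ)
    1<k : 1 < k
    1<k = s≤s (s≤s z≤n)
    2<k : 2 < k
    2<k = s≤s (s≤s (s≤s z≤n))
    first-descent : a ≤ at 1 × at 0 < a + m * m × block (at 1) < block (at 0)
    first-descent = descent (precedes z<s 1<k) (ordered 1<k z<s ≤-refl)
    a≤at1 : a ≤ at 1
    a≤at1 = proj₁ first-descent
    block1<block0 : block (at 1) < block (at 0)
    block1<block0 = proj₂ (proj₂ first-descent)
    rises : ∀ i → i < a → at (2 + i) < at (3 + i)
    rises i i<a = ordered (s≤s (s≤s (<-trans i<a (n<1+n a)))) (s≤s (s≤s (s≤s i<a)))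
      (subst₂ _<_ (sym (r-tail (<-trans i<a (n<1+n a)))) (sym (r-tail (s≤s i<a))) (n<1+n (2 + i)))
    last-large : a + m * m ≤ at 2 → nn ≤ at (suc m)
    last-large n≤at2 = ≤-trans (+-monoˡ-≤ a n≤at2) (ascending-run-gap (at ∘ (2 +_)) a rises)
    -- Otherwise the run at 2 < ⋯ < at (k - 1) would climb past the largest entry of E k.
    at2-middle : at 2 < a + m * m
    at2-middle = ≰⇒> λ n≤at2 → <⇒≱ (satisfies (n<1+n (suc m))) (last-large n≤at2)
    same-blocks : block (at 1) ≡ block (at 2)
    same-blocks = same-block (precedes (n<1+n 1) 2<k) (ordered 1<k 2<k (s≤s z≤n)) a≤at1 at2-middle
    lower-block : block (at 1) < block (at 2)
    lower-block = <-≤-trans block1<block0 (block-mono (<⇒≤ (ordered z<s 2<k ≤-refl)))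

  E-avoids-s : Avoids (E k) (s k)
  E-avoids-s occ = no-long-ascent (precedes z<s m<k) a≤at0 atm-middle (ascending-run-gap at m rises)
    where
    open Occurrence (E-occurrence length-s occ)
    below : ∀ {i} → i ≤ m → at (suc m) < at i
    below i≤m = ordered (n<1+n (suc m)) (s≤s (m≤n⇒m≤1+n i≤m)) (subst₂ _<_ (sym s-last) (sym (s-init (s≤s i≤m))) z<s)
    a≤at0 : a ≤ at 0
    a≤at0 = ≤-trans (proj₁ (descent (precedes z<s (n<1+n (suc m))) (below z≤n))) (<⇒≤ (below z≤n))
    atm-middle : at m < a + m * m
    atm-middle = proj₁ (proj₂ (descent (precedes (n<1+n m) (n<1+n (suc m))) (below ≤-refl)))
    rises : ∀ i → i < m → at i < at (suc i)
    rises i i<m = ordered (<-trans i<m m<k) (s≤s (s≤s (<⇒≤ i<m)))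
      (subst₂ _<_ (sym (s-init (m<n⇒m<1+n i<m))) (sym (s-init (s≤s i<m))) (n<1+n (suc i)))

  E-avoids-pᶜ : Avoids (E k) (comp (p k))
  E-avoids-pᶜ occ = no-descending-run (E-occurrence (trans (List.length-map _ (p k)) length-p) occ) id λ i i<m →
    n<1+n i , s≤s (s≤s (<⇒≤ i<m)) ,
    nth-comp-< (p k) length-p (s≤s (s≤s (<⇒≤ i<m))) (<-trans i<m m<k) (proj₁ (p-ascends i<m)) (proj₂ (p-ascends i<m))

  E-avoids-qᶜ : Avoids (E k) (comp (q k))
  E-avoids-qᶜ occ = no-long-ascent (precedes (s≤s (s≤s z≤n)) (n<1+n (suc m))) a≤at1 last-middle
                                   (ascending-run-gap (at ∘ suc) m rises)
    where
    open Occurrence (E-occurrence (trans (List.length-map _ (q k)) length-q) occ)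
    above : ∀ {i} → i ≤ m → at (suc i) < at 0
    above {i} i≤m = ordered (s≤s (s≤s i≤m)) z<s
      (nth-comp-< (q k) length-q (s≤s (s≤s i≤m)) z<s (subst (0 <_) (sym (q-tail (s≤s i≤m))) z<s) (q-bounded (s≤s i≤m)))
    a≤at1 : a ≤ at 1
    a≤at1 = proj₁ (descent (precedes z<s (s≤s (s≤s z≤n))) (above z≤n))
    last-middle : at (suc m) < a + m * m
    last-middle = <-trans (above ≤-refl) (proj₁ (proj₂ (descent (precedes z<s (n<1+n (suc m))) (above ≤-refl))))
    rises : ∀ i → i < m → at (suc i) < at (suc (suc i))
    rises i i<m = ordered (s≤s (s≤s (<⇒≤ i<m))) (s≤s (s≤s i<m))
      (nth-comp-< (q k) length-q (s≤s (s≤s (<⇒≤ i<m))) (s≤s (s≤s i<m)) (q-descends i<m) (q-bounded (m<n⇒m<1+n i<m)))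

  E-avoids-rᶜ : Avoids (E k) (comp (r k))
  E-avoids-rᶜ occ = no-descending-run (E-occurrence (trans (List.length-map _ (r k)) length-r) occ) chain run
    where
    chain : ℕ → ℕ
    chain zero    = 0
    chain (suc i) = 2 + i
    run : ∀ i → i < m → chain i < chain (suc i) × chain (suc i) < k × nth (comp (r k)) (chain (suc i)) < nth (comp (r k)) (chain i)
    run zero    _   = z<s , s≤s (s≤s (s≤s z≤n)) , nth-comp-< (r k) length-r (s≤s (s≤s (s≤s z≤n))) z<s ≤-refl (s≤s (s≤s (s≤s z≤n)))
    run (suc i) i<m = n<1+n (2 + i) , s≤s (s≤s i<m) ,
      nth-comp-< (r k) length-r (s≤s (s≤s i<m)) (s≤s (s≤s (<⇒≤ i<m)))
        (subst₂ _<_ (sym (r-tail (<-trans (n<1+n i) i<m))) (sym (r-tail i<m)) (n<1+n (2 + i)))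
        (subst (_< k) (sym (r-tail i<m)) (s≤s (s≤s i<m)))

  E-avoids-sᶜ : Avoids (E k) (comp (s k))
  E-avoids-sᶜ occ = no-descending-run (E-occurrence (trans (List.length-map _ (s k)) length-s) occ) id λ i i<m →
    n<1+n i , s≤s (s≤s (<⇒≤ i<m)) ,
    nth-comp-< (s k) length-s (s≤s (s≤s (<⇒≤ i<m))) (<-trans i<m m<k)
      (subst₂ _<_ (sym (s-init (m<n⇒m<1+n i<m))) (sym (s-init (s≤s i<m))) (n<1+n (suc i)))
      (subst (_< k) (sym (s-init (s≤s i<m))) (s≤s (s≤s i<m)))

  E-avoids-B : AvoidsAll (B k) (E k)
  E-avoids-B = E-avoids-p ∷ E-avoids-q ∷ E-avoids-r ∷ E-avoids-s ∷ E-avoids-pᶜ ∷ E-avoids-qᶜ ∷ E-avoids-rᶜ ∷ E-avoids-sᶜ ∷ []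

  IsPerm-E : IsPerm (E k)
  IsPerm-E = IsPerm-staircase

  k*k∸2*k≡2+nn : k * k ∸ 2 * k ≡ 2 + nn
  k*k∸2*k≡2+nn = trans (cong (_∸ 2 * k) (expand c)) (m+n∸n≡m (2 + nn) (2 * k))
    where
    expand : ∀ x → (4 + x) * (4 + x) ≡ 2 + (1 + x + (2 + x) * (2 + x) + (1 + x)) + 2 * (4 + x)
    expand = solve-∀

  length-E : length (E k) ≡ k * k ∸ 2 * k ∸ 2
  length-E = trans length-staircase (sym (cong (_∸ 2) k*k∸2*k≡2+nn))

  E-middle-start : nth (E k) a ≡ a + (1 + c) * m
  E-middle-start = begin
    nth (E k) a                                        ≡⟨ nth-++ˡ lower (subst (a <_) (sym length-lower) (m<m+n a z<s)) ⟩
    nth lower (0 + a)                                  ≡⟨ nth-++ʳ (upTo a) 0 (List.length-upTo a) ⟩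
    length (upTo a) + (length (skewPow (1 + c) m) + 0) ≡⟨ cong₂ _+_ (List.length-upTo a) (+-identityʳ _) ⟩
    a + length (skewPow (1 + c) m)                     ≡⟨ cong (a +_) (length-skewPow (1 + c) m) ⟩
    a + (1 + c) * m                                    ∎
    where open ≡-Reasoning

  E≢idP : E k ≢ idP nn
  E≢idP E≡id = m+1+n≢m a (begin
    a + (1 + c) * m ≡⟨ E-middle-start ⟨
    nth (E k) a     ≡⟨ cong (λ σ → nth σ a) E≡id ⟩
    nth (idP nn) a  ≡⟨ nth-applyUpTo id (<-≤-trans (m<m+n a z<s) (m≤m+n (a + m * m) a)) ⟩
    a               ∎)
    where open ≡-Reasoning

  E≢reverse-idP : E k ≢ reverse (idP nn)
  E≢reverse-idP E≡rev = m+1+n≢0 (c + m * m) (sym (begin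
    0                           ≡⟨ cong (λ σ → nth σ 0) E≡rev ⟩
    nth (reverse (idP nn)) 0    ≡⟨ cong (λ σ → nth σ 0) (List.reverse-upTo nn) ⟩
    nth (applyDownFrom id nn) 0 ≡⟨ nth-applyDownFrom id z<s ⟩
    nn ∸ 1                      ∎))
    where open ≡-Reasoning

  threshold-bound : ∀ N → IsThreshold k N → k * k ∸ 2 * k ∸ 1 ≤ N
  threshold-bound N threshold with N ≤? nn
  ... | no  N≰nn = subst (_≤ N) (sym (cong (_∸ 1) k*k∸2*k≡2+nn)) (≰⇒> N≰nn)
  ... | yes N≤nn = ⊥-elim ([ E≢idP , E≢reverse-idP ] (Equivalence.to (threshold nn N≤nn (E k) length-staircase IsPerm-E) E-avoids-B))

proposition7p4 : ∀ (k : ℕ) → 4 ≤ k →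
    (IsPerm (E k) × length (E k) ≡ k * k ∸ 2 * k ∸ 2 × AvoidsAll (B k) (E k))
    × (∀ (N : ℕ) → IsThreshold k N → k * k ∸ 2 * k ∸ 1 ≤ N)
proposition7p4 (suc (suc (suc (suc c)))) _ = (IsPerm-E c , length-E c , E-avoids-B c) , threshold-bound c
proposition7p4 (suc (suc (suc zero))) (s≤s (s≤s (s≤s ())))
proposition7p4 (suc (suc zero))       (s≤s (s≤s ()))
proposition7p4 (suc zero)             (s≤s ())
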